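{- For $i\ge 0$, let $S_i$ be the star graph with one central vertex and $i$ leaves (vertices adjacent only to the center), properly two-colored (center one color, leaves the other color). The Sprague–Grundy value of the \textsc{flag coloring} position on $S_i$ is $$\begin{cases} 0, & i=0,\\ \ast 1, & i \text{ odd},\\ \ast 2, & i\ge 2 \text{ and } i \text{ even}.\end{cases}$$
   Context: \textsc{flag coloring} is an impartial two-player game played on a simple graph whose vertices are colored. A move consists of choosing a vertex $v$, of color $c$ say, and a color $c'\neq c$ that is the color of some vertex adjacent to $v$; then $v$ and every vertex of the connected component of the subgraph induced by color-$c$ vertices that contains $v$ are recolored $c'$. Play is under the normal play convention: a player unable to move loses. Each position gets a Sprague–Grundy value (nimber) $\ast n$, where $n$ is the minimum non-negative integer not among the values of its options (positions with no options have value $0$); $\ast 1$ is also written $\ast$. -}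

module Defs where

open import Data.Nat using (ℕ; zero; suc; _<_)
open import Data.Fin using (Fin; zero; suc)
open import Data.Product using (Σ; ∃; _×_; _,_)
open import Data.Empty using (⊥)
open import Data.Unit using (⊤)
open import Relation.Nullary using (¬_)
open import Relation.Binary.PropositionalEquality using (_≡_; _≢_)

record Graph (n : ℕ) : Set₁ where
  field
    Adj       : Fin n → Fin n → Set
    Adj-sym   : ∀ {u v} → Adj u v → Adj v u
    Adj-irrefl : ∀ {v} → ¬ Adj v v

open Graph public

Coloring : ℕ → Set
Coloring n = Fin n → ℕ

-- Reach G c v w : w lies in the connected component containing v of the
-- subgraph induced by the vertices of color c v.
data Reach {n : ℕ} (G : Graph n) (c : Coloring n) (v : Fin n) : Fin n → Set where
  here : Reach G c v v
  step : ∀ {u w} → Reach G c v u → Adj G u w → c w ≡ c v → Reach G c v w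

Move : {n : ℕ} → Graph n → Coloring n → Coloring n → Set
Move {n} G c c' =
  Σ (Fin n) λ v → Σ ℕ λ d →
    d ≢ c v ×
    (∃ λ u → Adj G v u × c u ≡ d) ×
    (∀ w → (Reach G c v w → c' w ≡ d) × (¬ Reach G c v w → c' w ≡ c w))

-- SG G c k : the Sprague–Grundy value of position c (normal play) is k,
-- i.e. every option has a value, k is not the value of any option, and
-- every k' < k is the value of some option (k = mex of the option values).
data SG {n : ℕ} (G : Graph n) (c : Coloring n) (k : ℕ) : Set where
  sg : (∀ c' → Move G c c' → Σ ℕ λ m → SG G c' m × m ≢ k) →
       (∀ k' → k' < k → Σ (Coloring n) λ c' → Move G c c' × SG G c' k') →
       SG G c k

StarAdj : {i : ℕ} → Fin (suc i) → Fin (suc i) → Set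
StarAdj zero    zero    = ⊥
StarAdj zero    (suc _) = ⊤
StarAdj (suc _) zero    = ⊤
StarAdj (suc _) (suc _) = ⊥

Star : (i : ℕ) → Graph (suc i)
Star i = record
  { Adj = StarAdj
  ; Adj-sym = λ { {zero} {suc _} t → t ; {suc _} {zero} t → t
                ; {zero} {zero} () ; {suc _} {suc _} () }
  ; Adj-irrefl = λ { {zero} () ; {suc _} () }
  }

starColoring : (i : ℕ) → Coloring (suc i)
starColoring i zero    = 0
starColoring i (suc _) = 1

-- A star whose leaves carry either the center's color a or one other color b has
-- only two kinds of move: recoloring the center to b floods the star to a
-- one-colored, terminal position, and recoloring a b-leaf to a removes one
-- b-leaf. By induction on the number k of b-leaves the value is therefore
-- mex {0, value (k - 1)} for k ≥ 1, which is 0, ∗1, ∗2, ∗1, ∗2, … .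

module Submission where

open import Defs
open import Data.Nat using (ℕ; zero; suc; _≤_; _<_; _≟_; z≤n; s≤s)
open import Data.Nat.Divisibility using (_∣_; _∣0; ∣-refl; ∣m∣n⇒∣m+n; ∣m+n∣m⇒∣n; >⇒∤)
open import Data.Nat.Properties using (suc-injective)
open import Data.Fin using (Fin; zero; suc)
import Data.Fin.Properties as Fin
open import Data.Vec.Functional using (updateAt)
open import Data.Vec.Functional.Properties using (updateAt-updates; updateAt-minimal)
open import Data.Product using (Σ; ∃; _×_; _,_; proj₁; proj₂)
open import Data.Sum using (_⊎_; inj₁; inj₂)
open import Data.Unit using (tt)
open import Function using (_∘_; const)
open import Relation.Nullary using (¬_; yes; no; contradiction)
open import Relation.Binary.PropositionalEquality

module _ {n : ℕ} {G : Graph n} {c : Coloring n} where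

  Reach-color : ∀ {v w} → Reach G c v w → c w ≡ c v
  Reach-color here         = refl
  Reach-color (step _ _ e) = e

  Reach-isolated : ∀ {v w} → (∀ u → Adj G v u → c u ≢ c v) → Reach G c v w → w ≡ v
  Reach-isolated isolated here = refl
  Reach-isolated isolated (step r adj e) with Reach-isolated isolated r
  ... | refl = contradiction e (isolated _ adj)

  isolated-move : ∀ {v u} → (∀ u → Adj G v u → c u ≢ c v) → Adj G v u →
                  Move G c (updateAt c v (const (c u)))
  isolated-move {v} {u} isolated adj =
    v , c u , isolated u adj , (u , adj , refl) , λ w → recolored w , untouched w
    where
    recolored : ∀ w → Reach G c v w → updateAt c v (const (c u)) w ≡ c u
    recolored w r with Reach-isolated isolated r
    ... | refl = updateAt-updates v c
    untouched : ∀ w → ¬ Reach G c v w → updateAt c v (const (c u)) w ≡ c w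
    untouched w ¬r = updateAt-minimal w v c λ { refl → ¬r here }

  SG-monochromatic : ∀ {a} → (∀ w → c w ≡ a) → SG G c 0
  SG-monochromatic mono = sg (λ { _ (v , d , d≢cv , (u , _ , cu≡d) , _) →
                                    contradiction (trans (sym cu≡d) (trans (mono u) (sym (mono v)))) d≢cv })
                             (λ _ ())

Option : ∀ {n} → Graph n → Coloring n → ℕ → Set
Option {n} G c k = Σ (Coloring n) λ c' → Move G c c' × SG G c' k

-- mex {0, m}
mex₀ : ℕ → ℕ
mex₀ zero          = 1
mex₀ (suc zero)    = 2
mex₀ (suc (suc _)) = 1

mex₀≢0 : ∀ m → mex₀ m ≢ 0
mex₀≢0 zero          ()
mex₀≢0 (suc zero)    ()
mex₀≢0 (suc (suc _)) ()

mex₀≢id : ∀ m → mex₀ m ≢ m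
mex₀≢id zero          ()
mex₀≢id (suc zero)    ()
mex₀≢id (suc (suc zero)) ()
mex₀≢id (suc (suc (suc _))) ()

<mex₀ : ∀ {k} m → k < mex₀ m → k ≡ 0 ⊎ k ≡ m
<mex₀ {zero}           _                   _                 = inj₁ refl
<mex₀ {suc zero}       (suc zero)          _                 = inj₂ refl
<mex₀ {suc _}          zero                (s≤s ())
<mex₀ {suc (suc _)}    (suc zero)          (s≤s (s≤s ()))
<mex₀ {suc _}          (suc (suc _))       (s≤s ())

SG-mex₀ : ∀ {n} {G : Graph n} {c : Coloring n} m →
          (∀ c' → Move G c c' → Σ ℕ λ v → SG G c' v × (v ≡ 0 ⊎ v ≡ m)) →
          Option G c 0 → Option G c m → SG G c (mex₀ m)
SG-mex₀ m values zero-option m-option = sg avoided attained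
  where
  avoided : ∀ c' → Move _ _ c' → Σ ℕ λ v → SG _ c' v × v ≢ mex₀ m
  avoided c' mv with values c' mv
  ... | v , sgv , inj₁ refl = v , sgv , mex₀≢0 m ∘ sym
  ... | v , sgv , inj₂ refl = v , sgv , mex₀≢id m ∘ sym
  attained : ∀ k → k < mex₀ m → Option _ _ k
  attained k k<mex with <mex₀ m k<mex
  ... | inj₁ refl = zero-option
  ... | inj₂ refl = m-option

starValue : ℕ → ℕ
starValue zero    = 0
starValue (suc k) = mex₀ (starValue k)

starValue-odd : ∀ i → ¬ 2 ∣ i → starValue i ≡ 1
starValue-odd zero                2∤0 = contradiction (2 ∣0) 2∤0
starValue-odd (suc zero)          _   = refl
starValue-odd (suc (suc zero))    2∤2 = contradiction ∣-refl 2∤2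
starValue-odd (suc (suc (suc i))) 2∤i
  rewrite starValue-odd (suc i) (2∤i ∘ ∣m∣n⇒∣m+n ∣-refl) = refl

starValue-even : ∀ i → 2 ≤ i → 2 ∣ i → starValue i ≡ 2
starValue-even (suc zero)                (s≤s ()) _
starValue-even (suc (suc zero))          _ _   = refl
starValue-even (suc (suc (suc zero)))    _ 2∣3 = contradiction (∣m+n∣m⇒∣n 2∣3 ∣-refl) (>⇒∤ (s≤s (s≤s z≤n)))
starValue-even (suc (suc (suc (suc i)))) _ 2∣i
  rewrite starValue-even (suc (suc i)) (s≤s (s≤s z≤n)) (∣m+n∣m⇒∣n 2∣i ∣-refl) = refl

mismatches : ∀ {i} → (Fin i → ℕ) → ℕ → ℕ
mismatches {zero}  f a = 0
mismatches {suc i} f a with f zero ≟ a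
... | yes _ = mismatches (f ∘ suc) a
... | no _  = suc (mismatches (f ∘ suc) a)

mismatches-cong : ∀ {i} {f g : Fin i → ℕ} {a} → f ≗ g → mismatches f a ≡ mismatches g a
mismatches-cong {zero}  f≗g = refl
mismatches-cong {suc i} {f} {g} {a} f≗g with f zero ≟ a | g zero ≟ a
... | yes _   | yes _   = mismatches-cong (f≗g ∘ suc)
... | no _    | no _    = cong suc (mismatches-cong (f≗g ∘ suc))
... | yes f≡a | no g≢a  = contradiction (trans (sym (f≗g zero)) f≡a) g≢a
... | no f≢a  | yes g≡a = contradiction (trans (f≗g zero) g≡a) f≢a

mismatches-≡0 : ∀ {i} {f : Fin i → ℕ} {a} → mismatches f a ≡ 0 → ∀ j → f j ≡ a
mismatches-≡0 {suc i} {f} {a} none j with f zero ≟ a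
mismatches-≡0 {suc i} none zero    | yes f≡a = f≡a
mismatches-≡0 {suc i} none (suc j) | yes _   = mismatches-≡0 none j

mismatches-≡suc : ∀ {i} {f : Fin i → ℕ} {a k} → mismatches f a ≡ suc k → ∃ λ j → f j ≢ a
mismatches-≡suc {suc i} {f} {a} some with f zero ≟ a
... | no f≢a = zero , f≢a
... | yes _ with mismatches-≡suc some
...   | j , fj≢a = suc j , fj≢a

mismatches-all : ∀ {i} {f : Fin i → ℕ} {a} → (∀ j → f j ≢ a) → mismatches f a ≡ i
mismatches-all {zero}  all = refl
mismatches-all {suc i} {f} {a} all with f zero ≟ a
... | yes f≡a = contradiction f≡a (all zero)
... | no _    = cong suc (mismatches-all (all ∘ suc))

mismatches-fix : ∀ {i} {f g : Fin i → ℕ} {a} j → f j ≢ a → g j ≡ a →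
                 (∀ j' → j' ≢ j → g j' ≡ f j') → mismatches f a ≡ suc (mismatches g a)
mismatches-fix {suc i} {f} {g} {a} zero f≢a g≡a others with f zero ≟ a | g zero ≟ a
... | yes f≡a | _       = contradiction f≡a f≢a
... | _       | no g≢a  = contradiction g≡a g≢a
... | no _    | yes _   = cong suc (sym (mismatches-cong λ j → others (suc j) λ ()))
mismatches-fix {suc i} {f} {g} {a} (suc j) f≢a g≡a others
  with f zero ≟ a | g zero ≟ a
     | mismatches-fix j f≢a g≡a (λ j' j'≢j → others (suc j') (j'≢j ∘ Fin.suc-injective))
... | yes _   | yes _   | rest = rest
... | no _    | no _    | rest = cong suc rest
... | yes f≡a | no g≢a  | _    = contradiction (trans (others zero λ ()) f≡a) g≢a
... | no f≢a  | yes g≡a | _    = contradiction (trans (sym (others zero λ ())) g≡a) f≢a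

module _ {i : ℕ} where

  mismatchedLeaves : Coloring (suc i) → ℕ
  mismatchedLeaves c = mismatches (c ∘ suc) (c zero)

  Bicolored : Coloring (suc i) → ℕ → Set
  Bicolored c b = b ≢ c zero × (∀ j → c (suc j) ≡ c zero ⊎ c (suc j) ≡ b)

  LeafFlip : Coloring (suc i) → Coloring (suc i) → Fin i → Set
  LeafFlip c c' j = c (suc j) ≢ c zero × c' (suc j) ≡ c zero × (∀ w → w ≢ suc j → c' w ≡ c w)

  bicolored-mismatch : ∀ {c b j} → Bicolored c b → c (suc j) ≢ c zero → c (suc j) ≡ b
  bicolored-mismatch {j = j} (_ , leaves) cj≢c0 with leaves j
  ... | inj₁ cj≡c0 = contradiction cj≡c0 cj≢c0
  ... | inj₂ cj≡b  = cj≡b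

  leaf-isolated : ∀ {c : Coloring (suc i)} {j} → c (suc j) ≢ c zero →
                  ∀ u → Adj (Star i) (suc j) u → c u ≢ c (suc j)
  leaf-isolated cj≢c0 zero tt = cj≢c0 ∘ sym

  LeafFlip-bicolored : ∀ {c c' b j} → Bicolored c b → LeafFlip c c' j → Bicolored c' b
  LeafFlip-bicolored {c} {c'} {b} {j} (b≢c0 , leaves) (_ , flipped , others) =
    (λ b≡c0' → b≢c0 (trans b≡c0' center)) , leaves'
    where
    center : c' zero ≡ c zero
    center = others zero λ ()
    leaves' : ∀ j' → c' (suc j') ≡ c' zero ⊎ c' (suc j') ≡ b
    leaves' j' with j' Fin.≟ j
    ... | yes refl = inj₁ (trans flipped (sym center))
    ... | no j'≢j with leaves j'
    ...   | inj₁ e = inj₁ (trans (others (suc j') (j'≢j ∘ Fin.suc-injective)) (trans e (sym center)))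
    ...   | inj₂ e = inj₂ (trans (others (suc j') (j'≢j ∘ Fin.suc-injective)) e)

  LeafFlip-mismatches : ∀ {c c' j} → LeafFlip c c' j → mismatchedLeaves c ≡ suc (mismatchedLeaves c')
  LeafFlip-mismatches {c} {c'} {j} (cj≢c0 , flipped , others) =
    trans (mismatches-fix j cj≢c0 flipped λ j' j'≢j → others (suc j') (j'≢j ∘ Fin.suc-injective))
          (cong (λ a → suc (mismatches (c' ∘ suc) a)) (sym (others zero λ ())))

  star-move : ∀ {c c' b} → Bicolored c b → Move (Star i) c c' → (∀ w → c' w ≡ b) ⊎ ∃ (LeafFlip c c')
  star-move _ (zero , _ , _ , (zero , () , _) , _)
  star-move {c} {c'} {b} bc@(b≢c0 , leaves) (zero , d , d≢c0 , (suc j , tt , cj≡d) , recolor) =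
    inj₁ flooded
    where
    d≡b : d ≡ b
    d≡b = trans (sym cj≡d) (bicolored-mismatch {c} bc λ cj≡c0 → d≢c0 (trans (sym cj≡d) cj≡c0))
    flooded : ∀ w → c' w ≡ b
    flooded zero = trans (proj₁ (recolor zero) here) d≡b
    flooded (suc w) with leaves w
    ... | inj₁ cw≡c0 = trans (proj₁ (recolor (suc w)) (step here tt cw≡c0)) d≡b
    ... | inj₂ cw≡b  = trans (proj₂ (recolor (suc w)) λ r → b≢c0 (trans (sym cw≡b) (Reach-color r))) cw≡b
  star-move {c} {c'} _ (suc j , d , d≢cj , (zero , tt , c0≡d) , recolor) =
    inj₂ (j , cj≢c0 , trans (proj₁ (recolor (suc j)) here) (sym c0≡d) , others)
    where
    cj≢c0 : c (suc j) ≢ c zero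
    cj≢c0 cj≡c0 = d≢cj (trans (sym c0≡d) (sym cj≡c0))
    others : ∀ w → w ≢ suc j → c' w ≡ c w
    others w w≢j = proj₂ (recolor w) (w≢j ∘ Reach-isolated (leaf-isolated {c} cj≢c0))
  star-move _ (suc _ , _ , _ , (suc _ , () , _) , _)

  flood-move : ∀ {c b j} → Bicolored c b → c (suc j) ≡ b → Move (Star i) c (const b)
  flood-move {c} {b} {j} (b≢c0 , leaves) cj≡b =
    zero , b , b≢c0 , (suc j , tt , cj≡b) , λ w → (λ _ → refl) , unreached w
    where
    unreached : ∀ w → ¬ Reach (Star i) c zero w → b ≡ c w
    unreached zero    ¬r = contradiction here ¬r
    unreached (suc w) ¬r with leaves w
    ... | inj₁ cw≡c0 = contradiction (step here tt cw≡c0) ¬r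
    ... | inj₂ cw≡b  = sym cw≡b

  updateAt-LeafFlip : ∀ {c j} → c (suc j) ≢ c zero → LeafFlip c (updateAt c (suc j) (const (c zero))) j
  updateAt-LeafFlip {c} {j} cj≢c0 =
    cj≢c0 , updateAt-updates (suc j) c , λ w w≢j → updateAt-minimal w (suc j) c w≢j

  bicolored-SG : ∀ k {c b} → Bicolored c b → mismatchedLeaves c ≡ k → SG (Star i) c (starValue k)
  bicolored-SG zero {c} _ none = SG-monochromatic monochromatic
    where
    monochromatic : ∀ w → c w ≡ c zero
    monochromatic zero    = refl
    monochromatic (suc j) = mismatches-≡0 none j
  bicolored-SG (suc k) {c} {b} bc some = SG-mex₀ (starValue k) option-value flood-option flip-option
    where
    flip-SG : ∀ {c' j} → LeafFlip c c' j → SG (Star i) c' (starValue k)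
    flip-SG flip = bicolored-SG k (LeafFlip-bicolored bc flip)
                     (suc-injective (trans (sym (LeafFlip-mismatches flip)) some))
    option-value : ∀ c' → Move (Star i) c c' → Σ ℕ λ v → SG (Star i) c' v × (v ≡ 0 ⊎ v ≡ starValue k)
    option-value c' mv with star-move bc mv
    ... | inj₁ flooded    = 0 , SG-monochromatic flooded , inj₁ refl
    ... | inj₂ (_ , flip) = starValue k , flip-SG flip , inj₂ refl
    mismatched-leaf : ∃ λ j → c (suc j) ≢ c zero
    mismatched-leaf = mismatches-≡suc some
    cj≢c0 : c (suc (proj₁ mismatched-leaf)) ≢ c zero
    cj≢c0 = proj₂ mismatched-leaf
    flood-option : Option (Star i) c 0
    flood-option = const b , flood-move bc (bicolored-mismatch {c} bc cj≢c0) ,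
                   SG-monochromatic {a = b} λ _ → refl
    flip-option : Option (Star i) c (starValue k)
    flip-option = _ , isolated-move (leaf-isolated {c} cj≢c0) tt , flip-SG (updateAt-LeafFlip cj≢c0)

starColoring-SG : ∀ i → SG (Star i) (starColoring i) (starValue i)
starColoring-SG i = bicolored-SG i ((λ ()) , λ _ → inj₂ refl) (mismatches-all λ _ ())

theorem1 : SG (Star 0) (starColoring 0) 0
           × (∀ (i : ℕ) → ¬ (2 ∣ i) → SG (Star i) (starColoring i) 1)
           × (∀ (i : ℕ) → 2 ≤ i → 2 ∣ i → SG (Star i) (starColoring i) 2)
theorem1 = starColoring-SG 0
         , (λ i 2∤i → subst (SG (Star i) (starColoring i)) (starValue-odd i 2∤i) (starColoring-SG i))
         , (λ i 2≤i 2∣i → subst (SG (Star i) (starColoring i)) (starValue-even i 2≤i 2∣i) (starColoring-SG i))
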